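{- Let $V$ be a finite set viewed as a complete graph (clique), $l\ge1$, and $((V_{11},V_{12}),\dots,(V_{l1},V_{l2}))$ a list of pairs of subsets of $V$. Let $f=(f_1,\dots,f_l)\in\{0,1\}^l$, let $\mathcal{D}_f$ be the multifamily consisting of $V_{i1}\cap V_{i2}$ for each $i$ with $f_i=0$ and of the two sets $V_{i1},V_{i2}$ for each $i$ with $f_i=1$, and let $H_f$ be the bipartite graph with parts $\mathcal{D}_f$ and $V$ in which $D\in\mathcal{D}_f$ is adjacent to $v\in V$ iff $v\in D$. Then $H_f$ has a matching of size $|\mathcal{D}_f|$ if and only if there are pairwise vertex-disjoint paths $P_1,\dots,P_l$ in the clique on $V$ such that for each $i$: $P_i$ consists of a single vertex if $f_i=0$ and contains at least one edge if $f_i=1$; and one endpoint of $P_i$ belongs to $V_{i1}$ and the other endpoint belongs to $V_{i2}$.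
   Context: For a single-vertex path, both endpoints equal that vertex. -}

module Defs where

open import Data.Nat using (ℕ; suc)
open import Data.Bool using (Bool; true; false)
open import Data.Fin using (Fin)
open import Data.Fin.Subset using (Subset; _∩_) renaming (_∈_ to _∈ₛ_)
open import Data.Product using (_×_; _,_; proj₁; proj₂)
open import Data.List using (List; []; _∷_; length; map; concatMap; lookup)
open import Data.List.NonEmpty using (List⁺; toList; head; last)
open import Data.List.Relation.Unary.Unique.Propositional using (Unique)
open import Data.List.Relation.Unary.Linked using (Linked)
open import Data.List.Relation.Unary.All using (All)
open import Data.List.Membership.Propositional using (_∈_)
open import Data.Vec.Functional using (Vector)
open import Data.Sum using (_⊎_)
open import Data.Empty using (⊥)
open import Relation.Binary.PropositionalEquality using (_≡_; _≢_)

CliqueAdj : {n : ℕ} → Fin n → Fin n → Set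
CliqueAdj u v = u ≢ v

IsPath : {n : ℕ} → List⁺ (Fin n) → Set
IsPath P = Linked CliqueAdj (toList P) × Unique (toList P)

edges : {n : ℕ} → List⁺ (Fin n) → ℕ
edges P = Data.List.NonEmpty.length P Data.Nat.∸ 1

-- The multifamily D_f as a list of subsets (multiplicities kept).
Dfam : {n l : ℕ} → Vector (Subset n × Subset n) l → Vector Bool l → List (Subset n)
Dfam {l = l} V f = concatMap item (Data.List.allFin l)
  where
  item : Fin _ → List (Subset _)
  item i with f i
  ... | false = (proj₁ (V i) ∩ proj₂ (V i)) ∷ []
  ... | true  = proj₁ (V i) ∷ proj₂ (V i) ∷ []

HEdge : {n : ℕ} → (D : List (Subset n)) → Data.Fin.Fin (length D) × Fin n → Set
HEdge D (j , v) = v ∈ₛ lookup D j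

IsMatching : {n : ℕ} → (D : List (Subset n)) → List (Fin (length D) × Fin n) → Set
IsMatching D M = All (HEdge D) M × Unique (map proj₁ M) × Unique (map proj₂ M)

EndsIn : {n : ℕ} → List⁺ (Fin n) → Subset n → Subset n → Set
EndsIn P A B = (head P ∈ₛ A × last P ∈ₛ B) ⊎ (head P ∈ₛ B × last P ∈ₛ A)

Shape : {n : ℕ} → Bool → List⁺ (Fin n) → Set
Shape false P = edges P ≡ 0
Shape true  P = 1 Data.Nat.≤ edges P

PairwiseDisjoint : {n l : ℕ} → (Fin l → List⁺ (Fin n)) → Set
PairwiseDisjoint {n} {l} P = (i j : Fin l) → i ≢ j → (v : Fin n) → v ∈ toList (P i) → v ∈ toList (P j) → ⊥

-- A matching of H_f of size |D_f| saturates D_f, so it is the same thing as a system of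
-- distinct representatives (SDR) of D_f.  Since D_f is the concatenation of one block per
-- pair, an SDR of D_f splits into SDRs of the blocks with mutually disjoint vertex sets.
-- For f_i = 0 a representative of V_i1 ∩ V_i2 is a one-vertex path P_i; for f_i = 1 two
-- distinct representatives of V_i1 and V_i2 are joined by an edge of the clique.  Conversely
-- the endpoints of the paths P_i form SDRs of the blocks, distinct for f_i = 1 because a path
-- with an edge has distinct endpoints, and disjoint because they are vertices of the P_i.
module Submission where

open import Defs
open import Data.Nat using (ℕ; zero; suc; _≤_; s≤s; z≤n)
open import Data.Nat.Properties using (1+n≰n)
open import Data.Bool using (Bool; true; false)
open import Data.Fin using (Fin; zero; suc; punchOut; _≟_)
open import Data.Fin.Properties using (punchOut-injective; injective⇒≤)
open import Data.Fin.Subset using (Subset; _∩_) renaming (_∈_ to _∈ₛ_)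
open import Data.Fin.Subset.Properties using (x∈p∩q⁺; x∈p∩q⁻)
open import Data.Product using (_×_; Σ; ∃; ∃₂; _,_; proj₁; proj₂)
open import Data.Sum using (inj₁; inj₂)
open import Data.Empty using (⊥)
open import Data.List using (List; []; _∷_; _++_; length; map; concat; tabulate; allFin; lookup; concatMap; initLast; _∷ʳ′_)
open import Data.List.Properties using (map-tabulate; tabulate-cong; tabulate-lookup; length-tabulate; length-map)
open import Data.List.NonEmpty using (List⁺; _∷_; toList; last)
open import Data.List.Membership.Propositional using (_∈_)
open import Data.List.Membership.Propositional.Properties
  using (∈-++⁺ʳ; ∈-map⁺; ∈-map⁻; ∈-tabulate⁺; ∈-concat⁺′; ∈-lookup)
open import Data.List.Relation.Binary.Subset.Propositional using (_⊆_)
open import Data.List.Relation.Binary.Disjoint.Propositional using (Disjoint)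
open import Data.List.Relation.Binary.Pointwise as Pointwise using (Pointwise; []; _∷_)
open import Data.List.Relation.Unary.Any using (here; there; any?)
open import Data.List.Relation.Unary.All as All using ([]; _∷_)
import Data.List.Relation.Unary.All.Properties as All
open import Data.List.Relation.Unary.AllPairs using ([]; _∷_)
import Data.List.Relation.Unary.AllPairs.Properties as AllPairs
open import Data.List.Relation.Unary.Linked using ([-]; _∷_)
open import Data.List.Relation.Unary.Unique.Propositional using (Unique)
import Data.List.Relation.Unary.Unique.Propositional.Properties as Unique
open import Data.Vec.Functional as Vector using (Vector)
open import Function using (_∘_; id)
open import Function.Bundles using (_⇔_; mk⇔)
open import Relation.Nullary using (yes; no; contradiction)
open import Relation.Binary.PropositionalEquality using (_≡_; _≢_; _≗_; refl; sym; trans; cong; subst)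

module _ {A : Set} where

  Unique-tabulate⁻ : ∀ {m} {f : Fin m → A} → Unique (tabulate f) → ∀ {i j} → f i ≡ f j → i ≡ j
  Unique-tabulate⁻ _         {zero}  {zero}  _     = refl
  Unique-tabulate⁻ (fi∉ ∷ _) {zero}  {suc j} fi≡fj = contradiction fi≡fj (All.lookup fi∉ (∈-tabulate⁺ j))
  Unique-tabulate⁻ (fj∉ ∷ _) {suc i} {zero}  fi≡fj = contradiction (sym fi≡fj) (All.lookup fj∉ (∈-tabulate⁺ i))
  Unique-tabulate⁻ (_ ∷ u)   {suc i} {suc j} fi≡fj = cong suc (Unique-tabulate⁻ u fi≡fj)

  Unique-lookup-injective : (xs : List A) → Unique xs → ∀ {i j} → lookup xs i ≡ lookup xs j → i ≡ j
  Unique-lookup-injective xs u = Unique-tabulate⁻ (subst Unique (sym (tabulate-lookup xs)) u)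

  Unique-map⇒injectiveOn : ∀ {B : Set} (g : A → B) {xs : List A} → Unique (map g xs) →
                          ∀ {x y} → x ∈ xs → y ∈ xs → g x ≡ g y → x ≡ y
  Unique-map⇒injectiveOn g _         (here refl) (here refl) _     = refl
  Unique-map⇒injectiveOn g (gx∉ ∷ _) (here refl) (there y∈) gx≡gy =
    contradiction gx≡gy (All.lookup gx∉ (∈-map⁺ g y∈))
  Unique-map⇒injectiveOn g (gy∉ ∷ _) (there x∈) (here refl) gx≡gy =
    contradiction (sym gx≡gy) (All.lookup gy∉ (∈-map⁺ g x∈))
  Unique-map⇒injectiveOn g (_ ∷ u)   (there x∈) (there y∈) gx≡gy = Unique-map⇒injectiveOn g u x∈ y∈ gx≡gy

  Unique-++⁻ : (xs : List A) {ys : List A} → Unique (xs ++ ys) → Unique xs × Unique ys × Disjoint xs ys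
  Unique-++⁻ []       u         = [] , u , λ ()
  Unique-++⁻ (x ∷ xs) (x∉ ∷ u) with Unique-++⁻ xs u
  ... | u₁ , u₂ , disjoint = All.++⁻ˡ xs x∉ ∷ u₁ , u₂ , λ where
    (here refl , v∈ys) → All.lookup (All.++⁻ʳ xs x∉) v∈ys refl
    (there v∈xs , v∈ys) → disjoint (v∈xs , v∈ys)

  MutuallyDisjoint : ∀ {l} → Vector (List A) l → Set
  MutuallyDisjoint {l} Rs = (i j : Fin l) → i ≢ j → (v : A) → v ∈ Rs i → v ∈ Rs j → ⊥

  MutuallyDisjoint-⊆ : ∀ {l} {Rs Ss : Vector (List A) l} → (∀ i → Rs i ⊆ Ss i) →
                       MutuallyDisjoint Ss → MutuallyDisjoint Rs
  MutuallyDisjoint-⊆ Rs⊆Ss disjoint i j i≢j v v∈Rsi v∈Rsj =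
    disjoint i j i≢j v (Rs⊆Ss i v∈Rsi) (Rs⊆Ss j v∈Rsj)

  Unique-concat-tabulate⁻ : ∀ {l} (Rs : Vector (List A) l) → Unique (concat (tabulate Rs)) →
                            (∀ i → Unique (Rs i)) × MutuallyDisjoint Rs
  Unique-concat-tabulate⁻ {zero}  Rs _ = (λ ()) , λ ()
  Unique-concat-tabulate⁻ {suc l} Rs u with Unique-++⁻ (Rs zero) u
  ... | u₀ , u₊ , disjoint₀ with Unique-concat-tabulate⁻ (Rs ∘ suc) u₊
  ... | us , disjoint₊ = (λ { zero → u₀ ; (suc i) → us i }) , disjoint
    where
    disjoint : MutuallyDisjoint Rs
    disjoint zero    zero    0≢0 = contradiction refl 0≢0
    disjoint zero    (suc j) _   v v∈R₀ v∈Rⱼ = disjoint₀ (v∈R₀ , ∈-concat⁺′ v∈Rⱼ (∈-tabulate⁺ j))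
    disjoint (suc i) zero    _   v v∈Rᵢ v∈R₀ = disjoint₀ (v∈R₀ , ∈-concat⁺′ v∈Rᵢ (∈-tabulate⁺ i))
    disjoint (suc i) (suc j) i≢j = disjoint₊ i j (i≢j ∘ cong suc)

  last-∈-tail : (x : A) (xs : List A) → xs ≢ [] → last (x ∷ xs) ∈ xs
  last-∈-tail x xs xs≢[] with initLast xs
  ... | []       = contradiction refl xs≢[]
  ... | ys ∷ʳ′ y = ∈-++⁺ʳ ys (here refl)

module _ {A B : Set} {R : A → B → Set} where

  Pointwise-tabulate-lookup⁺ : {ys : List B} {f : Fin (length ys) → A} →
                               (∀ j → R (f j) (lookup ys j)) → Pointwise R (tabulate f) ys
  Pointwise-tabulate-lookup⁺ {ys} {f} h =
    subst (Pointwise R (tabulate f)) (tabulate-lookup ys) (Pointwise.tabulate⁺ h)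

  Pointwise-tabulate-lookup⁻ : {xs : List A} {ys : List B} → Pointwise R xs ys →
                               ∃ λ (f : Fin (length ys) → A) → tabulate f ≡ xs × (∀ j → R (f j) (lookup ys j))
  Pointwise-tabulate-lookup⁻ [] = (λ ()) , refl , λ ()
  Pointwise-tabulate-lookup⁻ (_∷_ {x = x} r rs) with Pointwise-tabulate-lookup⁻ rs
  ... | f , refl , h = x Vector.∷ f , refl , λ { zero → r ; (suc j) → h j }

  Pointwise-++⁻ : (ys₁ : List B) {ys₂ : List B} {xs : List A} → Pointwise R xs (ys₁ ++ ys₂) →
                  ∃₂ λ xs₁ xs₂ → xs₁ ++ xs₂ ≡ xs × Pointwise R xs₁ ys₁ × Pointwise R xs₂ ys₂
  Pointwise-++⁻ []        rs       = [] , _ , refl , [] , rs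
  Pointwise-++⁻ (y ∷ ys₁) (r ∷ rs) with Pointwise-++⁻ ys₁ rs
  ... | xs₁ , xs₂ , refl , rs₁ , rs₂ = _ ∷ xs₁ , xs₂ , refl , r ∷ rs₁ , rs₂

  Pointwise-concat-tabulate⁻ : ∀ {l} (G : Vector (List B) l) {xs : List A} →
                               Pointwise R xs (concat (tabulate G)) →
                               ∃ λ (Rs : Vector (List A) l) →
                                 concat (tabulate Rs) ≡ xs × (∀ i → Pointwise R (Rs i) (G i))
  Pointwise-concat-tabulate⁻ {zero}  G [] = (λ ()) , refl , λ ()
  Pointwise-concat-tabulate⁻ {suc l} G rs with Pointwise-++⁻ (G zero) rs
  ... | xs₀ , _ , refl , rs₀ , rs₊ with Pointwise-concat-tabulate⁻ (G ∘ suc) rs₊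
  ... | Rs , refl , pws = xs₀ Vector.∷ Rs , refl , λ { zero → rs₀ ; (suc i) → pws i }

Unique-length⇒∈ : ∀ {m} (xs : List (Fin m)) → Unique xs → length xs ≡ m → ∀ j → j ∈ xs
Unique-length⇒∈ {suc m} xs u |xs|≡1+m j with any? (j ≟_) xs
... | yes j∈xs = j∈xs
... | no  j∉xs = contradiction (subst (_≤ m) |xs|≡1+m (injective⇒≤ squeeze-injective)) 1+n≰n
  where
  j≢lookup : ∀ k → j ≢ lookup xs k
  j≢lookup k refl = j∉xs (∈-lookup k)
  squeeze : Fin (length xs) → Fin m
  squeeze k = punchOut (j≢lookup k)
  squeeze-injective : ∀ {k k′} → squeeze k ≡ squeeze k′ → k ≡ k′
  squeeze-injective {k} {k′} eq =
    Unique-lookup-injective xs u (punchOut-injective (j≢lookup k) (j≢lookup k′) eq)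

module _ {n : ℕ} where

  IsSDR : List (Fin n) → List (Subset n) → Set
  IsSDR rs D = Pointwise _∈ₛ_ rs D × Unique rs

  SDR : List (Subset n) → Set
  SDR D = Σ (List (Fin n)) λ rs → IsSDR rs D

  SaturatingMatching : List (Subset n) → Set
  SaturatingMatching D = Σ (List (Fin (length D) × Fin n)) λ M → IsMatching D M × length M ≡ length D

  matching⇒SDR : (D : List (Subset n)) → SaturatingMatching D → SDR D
  matching⇒SDR D (M , (edges , left-unique , right-unique) , |M|≡|D|) =
    tabulate partner , Pointwise-tabulate-lookup⁺ partner∈ , Unique.tabulate⁺ partner-injective
    where
    edge-at : ∀ j → ∃ λ e → e ∈ M × j ≡ proj₁ e
    edge-at j = ∈-map⁻ proj₁ (Unique-length⇒∈ (map proj₁ M) left-unique (trans (length-map proj₁ M) |M|≡|D|) j)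
    partner : Fin (length D) → Fin n
    partner j = proj₂ (proj₁ (edge-at j))
    partner∈ : ∀ j → partner j ∈ₛ lookup D j
    partner∈ j with edge-at j
    ... | _ , e∈M , refl = All.lookup edges e∈M
    partner-injective : ∀ {j k} → partner j ≡ partner k → j ≡ k
    partner-injective {j} {k} eq with edge-at j | edge-at k
    ... | _ , e∈M , refl | _ , e′∈M , refl = cong proj₁ (Unique-map⇒injectiveOn proj₂ right-unique e∈M e′∈M eq)

  SDR⇒matching : (D : List (Subset n)) → SDR D → SaturatingMatching D
  SDR⇒matching D (rs , pw , u) with Pointwise-tabulate-lookup⁻ pw
  ... | r , refl , r∈ = M , (All.tabulate⁺ r∈ , left-unique , right-unique) , length-tabulate _
    where
    M : List (Fin (length D) × Fin n)
    M = tabulate λ j → j , r j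
    left-unique : Unique (map proj₁ M)
    left-unique = subst Unique (sym (map-tabulate _ proj₁)) (Unique.allFin⁺ _)
    right-unique : Unique (map proj₂ M)
    right-unique = subst Unique (sym (map-tabulate _ proj₂)) u

  BlockSDRs : ∀ {l} → Vector (List (Subset n)) l → Set
  BlockSDRs {l} G = Σ (Vector (List (Fin n)) l) λ Rs → (∀ i → IsSDR (Rs i) (G i)) × MutuallyDisjoint Rs

  SDR-concat⁻ : ∀ {l} (G : Vector (List (Subset n)) l) → SDR (concat (tabulate G)) → BlockSDRs G
  SDR-concat⁻ G (rs , pw , u) with Pointwise-concat-tabulate⁻ G pw
  ... | Rs , refl , pws with Unique-concat-tabulate⁻ Rs u
  ... | us , disjoint = Rs , (λ i → pws i , us i) , disjoint

  SDR-concat⁺ : ∀ {l} (G : Vector (List (Subset n)) l) → BlockSDRs G → SDR (concat (tabulate G))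
  SDR-concat⁺ G (Rs , sdrs , disjoint) =
    concat (tabulate Rs) ,
    Pointwise.concat⁺ (Pointwise.tabulate⁺ (proj₁ ∘ sdrs)) ,
    Unique.concat⁺ (All.tabulate⁺ (proj₂ ∘ sdrs))
                   (AllPairs.tabulate⁺ λ {i} {j} i≢j (v∈Rsi , v∈Rsj) → disjoint i j i≢j _ v∈Rsi v∈Rsj)

  block : Subset n × Subset n → Bool → List (Subset n)
  block (A , B) false = A ∩ B ∷ []
  block (A , B) true  = A ∷ B ∷ []

  Admissible : Bool → Subset n × Subset n → List⁺ (Fin n) → Set
  Admissible b (A , B) P = IsPath P × Shape b P × EndsIn P A B

  block-SDR⇒path : ∀ p b {rs} → IsSDR rs (block p b) → Σ (List⁺ (Fin n)) λ P → Admissible b p P × toList P ⊆ rs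
  block-SDR⇒path (A , B) false (v∈A∩B ∷ [] , _) =
    _ ∷ [] , (([-] , [] ∷ []) , refl , inj₁ (x∈p∩q⁻ A B v∈A∩B)) , λ v∈ → v∈
  block-SDR⇒path (A , B) true  (a∈A ∷ b∈B ∷ [] , u@((a≢b ∷ []) ∷ _)) =
    _ ∷ _ ∷ [] , ((a≢b ∷ [-] , u) , s≤s z≤n , inj₁ (a∈A , b∈B)) , λ v∈ → v∈

  path⇒block-SDR : ∀ p b P → Admissible b p P → Σ (List (Fin n)) λ rs → IsSDR rs (block p b) × rs ⊆ toList P
  path⇒block-SDR (A , B) false (x ∷ [])    (_ , _ , inj₁ (x∈A , x∈B)) =
    x ∷ [] , (x∈p∩q⁺ (x∈A , x∈B) ∷ [] , [] ∷ []) , λ v∈ → v∈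
  path⇒block-SDR (A , B) false (x ∷ [])    (_ , _ , inj₂ (x∈B , x∈A)) =
    x ∷ [] , (x∈p∩q⁺ (x∈A , x∈B) ∷ [] , [] ∷ []) , λ v∈ → v∈
  path⇒block-SDR (A , B) false (x ∷ _ ∷ _) (_ , () , _)
  path⇒block-SDR (A , B) true  (x ∷ [])    (_ , () , _)
  path⇒block-SDR (A , B) true  (x ∷ y ∷ ys) ((_ , x∉ ∷ _) , _ , ends) with last-∈-tail x (y ∷ ys) (λ ()) | ends
  ... | last∈ | inj₁ (x∈A , z∈B) = x ∷ _ ∷ [] , (x∈A ∷ z∈B ∷ [] , (x≢z ∷ []) ∷ [] ∷ []) , λ where
          (here refl) → here refl
          (there (here refl)) → there last∈
    where x≢z = All.lookup x∉ last∈
  ... | last∈ | inj₂ (x∈B , z∈A) = _ ∷ x ∷ [] , (z∈A ∷ x∈B ∷ [] , (z≢x ∷ []) ∷ [] ∷ []) , λ where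
          (here refl) → there last∈
          (there (here refl)) → here refl
    where z≢x = All.lookup x∉ last∈ ∘ sym

module _ {n l : ℕ} (V : Vector (Subset n × Subset n) l) (f : Vector Bool l) where

  blocks : Vector (List (Subset n)) l
  blocks i = block (V i) (f i)

  -- `Dfam` builds its blocks with a local function that is out of scope here;
  -- unifying `Dfam V f` with `concatMap g (allFin l)` recovers it as `g`.
  Dfam-local-block : Vector (List (Subset n)) l
  Dfam-local-block = recover refl
    where
    recover : ∀ {g : Vector (List (Subset n)) l} →
              Dfam V f ≡ concatMap g (allFin l) → Vector (List (Subset n)) l
    recover {g} _ = g

  Dfam-local-block≗blocks : Dfam-local-block ≗ blocks
  Dfam-local-block≗blocks i with f i
  ... | false = refl
  ... | true  = refl

  Dfam-blocks : Dfam V f ≡ concat (tabulate blocks)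
  Dfam-blocks = cong concat (trans (map-tabulate id Dfam-local-block) (tabulate-cong Dfam-local-block≗blocks))

  Linkage : Set
  Linkage = Σ (Fin l → List⁺ (Fin n)) λ P → PairwiseDisjoint P × (∀ i → Admissible (f i) (V i) (P i))

  blockSDRs⇒linkage : BlockSDRs blocks → Linkage
  blockSDRs⇒linkage (Rs , sdrs , disjoint) =
    (λ i → proj₁ (path i)) ,
    MutuallyDisjoint-⊆ (λ i → proj₂ (proj₂ (path i))) disjoint ,
    (λ i → proj₁ (proj₂ (path i)))
    where
    path : ∀ i → Σ (List⁺ (Fin n)) λ P → Admissible (f i) (V i) P × toList P ⊆ Rs i
    path i = block-SDR⇒path (V i) (f i) (sdrs i)

  linkage⇒blockSDRs : Linkage → BlockSDRs blocks
  linkage⇒blockSDRs (P , disjoint , admissible) =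
    (λ i → proj₁ (sdr i)) ,
    (λ i → proj₁ (proj₂ (sdr i))) ,
    MutuallyDisjoint-⊆ (λ i → proj₂ (proj₂ (sdr i))) disjoint
    where
    sdr : ∀ i → Σ (List (Fin n)) λ rs → IsSDR rs (blocks i) × rs ⊆ toList (P i)
    sdr i = path⇒block-SDR (V i) (f i) (P i) (admissible i)

lemma30 : (n l : ℕ) → 1 ≤ l → (V : Vector (Subset n × Subset n) l) → (f : Vector Bool l) →
    (Σ (List (Fin (length (Dfam V f)) × Fin n)) (λ M → IsMatching (Dfam V f) M × length M ≡ length (Dfam V f)))
    ⇔ Σ (Fin l → List⁺ (Fin n)) (λ P → PairwiseDisjoint P × ((i : Fin l) → IsPath (P i) × Shape (f i) (P i) × EndsIn (P i) (Data.Product.proj₁ (V i)) (Data.Product.proj₂ (V i))))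
lemma30 n l _ V f = mk⇔
  (blockSDRs⇒linkage V f ∘ SDR-concat⁻ (blocks V f) ∘ subst SDR (Dfam-blocks V f) ∘ matching⇒SDR (Dfam V f))
  (SDR⇒matching (Dfam V f) ∘ subst SDR (sym (Dfam-blocks V f)) ∘ SDR-concat⁺ (blocks V f) ∘ linkage⇒blockSDRs V f)
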